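{- For integers $0\leq n_1\leq n$, $$\sum_{k=0}^{n_1}(-1)^{n_1+k}\binom{n}{k}\binom{k+n}{n}=\sum_{k=0}^{n_1}\binom{n}{k}^2\binom{n-k-1}{n_1-k},$$ and, if moreover $n\geq 1$, $$\sum_{k=0}^{n_1}N_{n,k+1}\binom{n-k-1}{n_1-k}=\sum_{k=0}^{n_1}\frac{(-1)^{k+n_1}}{k+n+1}\binom{n}{k}\binom{k+n+1}{n}.$$
   Context: For integer $a$ and integer $b$, $\binom{a}{b}=a(a-1)\cdots(a-b+1)/b!$ if $b\geq 0$ and $0$ if $b<0$ (so $\binom{ -1}{0}=1$). The Narayana numbers are $N_{n,k}=\frac{1}{n}\binom{n}{k}\binom{n}{k-1}$ for $n\geq 1$. -}

module Defs where

open import Data.Nat as ℕ using (ℕ; zero; suc; _!; NonZero)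
open import Data.Nat.Properties using (_!≢0)
open import Data.Integer as ℤ using (ℤ; +_; -[1+_])
open import Data.Rational as ℚ using (ℚ; 0ℚ; 1ℚ)

fallingℤ : ℤ → ℕ → ℤ
fallingℤ a zero = ℤ.1ℤ
fallingℤ a (suc b) = fallingℤ a b ℤ.* (a ℤ.- + b)

binom : ℤ → ℤ → ℚ
binom a (+ b) = (fallingℤ a b ℚ./ (b !)) {{b !≢0}}
binom a -[1+ _ ] = 0ℚ

narayana : (n : ℕ) → .{{NonZero n}} → ℤ → ℚ
narayana n k = (ℤ.1ℤ ℚ./ n) ℚ.* (binom (+ n) k ℚ.* binom (+ n) (k ℤ.- ℤ.1ℤ))

signℚ : ℕ → ℚ
signℚ zero = 1ℚ
signℚ (suc m) = ℚ.- signℚ m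

sumTo : ℕ → (ℕ → ℚ) → ℚ
sumTo zero f = f 0
sumTo (suc m) f = sumTo m f ℚ.+ f (suc m)

module Submission where

-- Both identities are instances of one inversion formula.  For a weight
-- g : ℕ → ℕ and n fixed, put
--   T_g(j) = C(n,j) Σ_{k≤j} g(k) C(j,k),   R_g(m) = Σ_{k≤m} g(k) C(n,k) C(n-k-1,m-k).
-- Pascal's rule in the last factor of R_g together with
-- C(n,k) C(n-k,j-k) = C(n,j) C(j,k) gives R_g(m+1) + R_g(m) = T_g(m+1) for m < n,
-- and R_g(0) = T_g(0); unwinding this recurrence gives
--   Σ_{k≤m} (-1)^{m+k} T_g(k) = R_g(m)      (m ≤ n).
-- By Vandermonde's convolution, T_g(k) = C(n,k) C(k+n,n) for g(k) = C(n,k), which is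
-- the first identity, and T_g(k) = C(n,k) C(k+n,n-1) for g(k) = C(n,k+1), which
-- by absorption and N_{n,k+1} = C(n,k+1) C(n,k)/n is the second.

open import Defs
open import Data.Nat as ℕ using (ℕ; NonZero; suc)
open import Data.Integer as ℤ using (+_)
open import Data.Rational as ℚ using (ℚ)
open import Data.Product using (_×_; _,_)
open import Data.Nat using (_≤_; s≤s; z≤n)
import Data.Nat.Properties as ℕP
open import Data.Nat.Combinatorics using (_C_)
import Data.Rational.Properties as ℚP
import Data.Rational.Solver as ℚSolver
open import Relation.Binary.PropositionalEquality using (_≡_; refl; sym; trans; cong; cong₂; module ≡-Reasoning)

module BinomialIdentities where

  open import Data.Nat using (zero; _+_; _*_; _∸_; _<_; _!)
  open import Data.Nat.Properties
  open import Data.Nat.DivMod using (_/_; m/n*n≡m)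
  open import Data.Nat.Combinatorics
    using (nCk≡n!/k![n-k]!; k![n∸k]!∣n!; k>n⇒nCk≡0; nCk≡nC[n∸k]; nCk+nC[k+1]≡[n+1]C[k+1])
  open import Data.Sum using (inj₁; inj₂)
  open import Relation.Binary.PropositionalEquality
  open import Data.Nat.Solver using (module +-*-Solver)
  open +-*-Solver
  open ≡-Reasoning

  pascal : ∀ n k → suc n C suc k ≡ n C k + n C suc k
  pascal n k = sym (nCk+nC[k+1]≡[n+1]C[k+1] n k)

  C-factorial : ∀ b c → ((b + c) C b) * (b ! * c !) ≡ (b + c) !
  C-factorial b c = begin
      ((b + c) C b) * (b ! * c !)                  ≡⟨ cong (λ x → ((b + c) C b) * (b ! * x !)) (sym (m+n∸m≡n b c)) ⟩
      ((b + c) C b) * d                            ≡⟨ cong (_* d) (nCk≡n!/k![n-k]! b≤b+c) ⟩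
      (b + c) ! / d * d                            ≡⟨ m/n*n≡m (k![n∸k]!∣n! b≤b+c) ⟩
      (b + c) !                                    ∎
    where
    b≤b+c = m≤m+n b c
    d = b ! * (b + c ∸ b) !
    instance _ = b !* (b + c ∸ b) !≢0

  cancel-factorials : ∀ {x y} b c → x * (b ! * c !) ≡ y * (b ! * c !) → x ≡ y
  cancel-factorials {x} {y} b c = *-cancelʳ-≡ x y (b ! * c !) {{b !* c !≢0}}

  C-sym : ∀ b c → (b + c) C b ≡ (b + c) C c
  C-sym b c = trans (nCk≡nC[n∸k] (m≤m+n b c)) (cong ((b + c) C_) (m+n∸m≡n b c))

  -- (k+1) C(n,k+1) = (n-k) C(n,k), valid for all n and k (both sides
  -- vanish when n ≤ k); it is the recurrence of the falling factorial.
  C-step : ∀ n k → suc k * (n C suc k) ≡ (n ∸ k) * (n C k)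
  C-step n k with ≤-<-connex n k
  ... | inj₁ n≤k = begin
      suc k * (n C suc k)  ≡⟨ cong (suc k *_) (k>n⇒nCk≡0 (s≤s n≤k)) ⟩
      suc k * 0          ≡⟨ *-zeroʳ (suc k) ⟩
      0                  ≡⟨ cong (_* (n C k)) (sym (m≤n⇒m∸n≡0 n≤k)) ⟩
      (n ∸ k) * (n C k)    ∎
  ... | inj₂ k<n with m≤n⇒∃[o]m+o≡n k<n
  ...   | c , refl = cancel-factorials k c (begin
      suc k * A * (k ! * c !)       ≡⟨ solve 4 (λ sk a kf cf → sk :* a :* (kf :* cf) := a :* ((sk :* kf) :* cf)) refl (suc k) A (k !) (c !) ⟩
      A * (suc k ! * c !)           ≡⟨ C-factorial (suc k) c ⟩
      (suc k + c) !                 ≡⟨ cong _! (sym (+-suc k c)) ⟩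
      (k + suc c) !                 ≡⟨ sym (C-factorial k (suc c)) ⟩
      B′ * (k ! * suc c !)          ≡⟨ cong (λ z → (z C k) * (k ! * suc c !)) (+-suc k c) ⟩
      B * (k ! * (suc c * c !))     ≡⟨ solve 4 (λ b kf sc cf → b :* (kf :* (sc :* cf)) := sc :* b :* (kf :* cf)) refl B (k !) (suc c) (c !) ⟩
      suc c * B * (k ! * c !)       ≡⟨ cong (λ z → z * B * (k ! * c !)) (sym n∸k≡1+c) ⟩
      (suc k + c ∸ k) * B * (k ! * c !) ∎)
    where
    A = (suc k + c) C suc k
    B = (suc k + c) C k
    B′ = (k + suc c) C k
    n∸k≡1+c : suc k + c ∸ k ≡ suc c
    n∸k≡1+c = trans (cong (_∸ k) (sym (+-suc k c))) (m+n∸m≡n k (suc c))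

  absorption : ∀ {m k} → k ≤ m → suc k * (suc m C suc k) ≡ suc m * (m C k)
  absorption {k = k} k≤m with m≤n⇒∃[o]m+o≡n k≤m
  ... | c , refl = cancel-factorials k c (begin
      suc k * A * (k ! * c !)       ≡⟨ solve 4 (λ sk a kf cf → sk :* a :* (kf :* cf) := a :* ((sk :* kf) :* cf)) refl (suc k) A (k !) (c !) ⟩
      A * (suc k ! * c !)           ≡⟨ C-factorial (suc k) c ⟩
      suc (k + c) * (k + c) !       ≡⟨ cong (suc (k + c) *_) (sym (C-factorial k c)) ⟩
      suc (k + c) * (B * (k ! * c !)) ≡⟨ sym (*-assoc (suc (k + c)) B (k ! * c !)) ⟩
      suc (k + c) * B * (k ! * c !) ∎)
    where
    A = suc (k + c) C suc k
    B = (k + c) C k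

  -- Choosing k out of n and then j-k out of the rest is choosing j out of n
  -- and then k out of those j:  C(n,k) C(n-k,j-k) = C(n,j) C(j,k).
  C-subset : ∀ {n j k} → k ≤ j → j ≤ n → (n C k) * ((n ∸ k) C (j ∸ k)) ≡ (n C j) * (j C k)
  C-subset {k = k} k≤j j≤n with m≤n⇒∃[o]m+o≡n k≤j | m≤n⇒∃[o]m+o≡n j≤n
  ... | q , refl | p , refl = begin
      A * ((N ∸ k) C (k + q ∸ k))   ≡⟨ cong₂ (λ a b → A * (a C b)) N∸k≡q+p (m+n∸m≡n k q) ⟩
      A * B                         ≡⟨ cancel-factorials k q (*-cancelʳ-≡ _ _ (p !) {{p !≢0}} factorials) ⟩
      E * D                         ∎
    where
    N = k + q + p
    A = N C k
    B = (q + p) C q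
    D = (k + q) C k
    E = N C (k + q)
    N∸k≡q+p : N ∸ k ≡ q + p
    N∸k≡q+p = trans (cong (_∸ k) (+-assoc k q p)) (m+n∸m≡n k (q + p))
    factorials : A * B * (k ! * q !) * p ! ≡ E * D * (k ! * q !) * p !
    factorials = begin
      A * B * (k ! * q !) * p !       ≡⟨ solve 5 (λ a b kf qf pf → a :* b :* (kf :* qf) :* pf := a :* (kf :* (b :* (qf :* pf)))) refl A B (k !) (q !) (p !) ⟩
      A * (k ! * (B * (q ! * p !)))   ≡⟨ cong (λ z → A * (k ! * z)) (C-factorial q p) ⟩
      A * (k ! * (q + p) !)           ≡⟨ cong (λ z → (z C k) * (k ! * (q + p) !)) (+-assoc k q p) ⟩
      ((k + (q + p)) C k) * (k ! * (q + p) !) ≡⟨ C-factorial k (q + p) ⟩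
      (k + (q + p)) !                 ≡⟨ cong _! (sym (+-assoc k q p)) ⟩
      N !                             ≡⟨ sym (C-factorial (k + q) p) ⟩
      E * ((k + q) ! * p !)           ≡⟨ cong (λ z → E * (z * p !)) (sym (C-factorial k q)) ⟩
      E * (D * (k ! * q !) * p !)     ≡⟨ solve 5 (λ e d kf qf pf → e :* (d :* (kf :* qf) :* pf) := e :* d :* (kf :* qf) :* pf) refl E D (k !) (q !) (p !) ⟩
      E * D * (k ! * q !) * p !       ∎

  sumN : ℕ → (ℕ → ℕ) → ℕ
  sumN zero f = f 0
  sumN (suc m) f = sumN m f + f (suc m)

  sumN-cong : ∀ m {f g : ℕ → ℕ} → (∀ k → k ≤ m → f k ≡ g k) → sumN m f ≡ sumN m g
  sumN-cong zero f≡g = f≡g 0 z≤n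
  sumN-cong (suc m) f≡g = cong₂ _+_ (sumN-cong m (λ k k≤m → f≡g k (m≤n⇒m≤1+n k≤m))) (f≡g (suc m) ≤-refl)

  sumN-+ : ∀ m (f g : ℕ → ℕ) → sumN m (λ k → f k + g k) ≡ sumN m f + sumN m g
  sumN-+ zero f g = refl
  sumN-+ (suc m) f g = begin
      sumN m (λ k → f k + g k) + (f (suc m) + g (suc m))  ≡⟨ cong (_+ (f (suc m) + g (suc m))) (sumN-+ m f g) ⟩
      sumN m f + sumN m g + (f (suc m) + g (suc m))       ≡⟨ solve 4 (λ a b c d → a :+ b :+ (c :+ d) := a :+ c :+ (b :+ d)) refl
                                                                     (sumN m f) (sumN m g) (f (suc m)) (g (suc m)) ⟩
      sumN m f + f (suc m) + (sumN m g + g (suc m))       ∎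

  sumN-*ˡ : ∀ m x (f : ℕ → ℕ) → sumN m (λ k → x * f k) ≡ x * sumN m f
  sumN-*ˡ zero x f = refl
  sumN-*ˡ (suc m) x f = trans (cong (_+ x * f (suc m)) (sumN-*ˡ m x f)) (sym (*-distribˡ-+ x (sumN m f) (f (suc m))))

  sumN-shift : ∀ j (f : ℕ → ℕ) → sumN (suc j) f ≡ f 0 + sumN j (λ k → f (suc k))
  sumN-shift zero f = refl
  sumN-shift (suc j) f = trans (cong (_+ f (suc (suc j))) (sumN-shift j f)) (+-assoc (f 0) _ _)

  vandermonde : ∀ a b j → sumN j (λ k → (a C k) * (b C (j ∸ k))) ≡ (a + b) C j
  vandermonde a b zero = refl
  vandermonde zero b (suc j) = begin
      sumN (suc j) (λ k → (0 C k) * (b C (suc j ∸ k)))          ≡⟨ sumN-shift j _ ⟩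
      1 * (b C suc j) + sumN j (λ k → 0 * (b C (j ∸ k)))        ≡⟨ cong₂ _+_ (*-identityˡ (b C suc j)) (sumN-*ˡ j 0 (λ k → b C (j ∸ k))) ⟩
      b C suc j + 0                                             ≡⟨ +-identityʳ (b C suc j) ⟩
      b C suc j                                                 ∎
  vandermonde (suc a) b (suc j) = begin
      sumN (suc j) (λ k → (suc a C k) * (b C (suc j ∸ k)))
    ≡⟨ sumN-shift j _ ⟩
      first + sumN j (λ k → (suc a C suc k) * (b C (j ∸ k)))
    ≡⟨ cong (λ s → first + s) (sumN-cong j (λ k _ → cong (_* (b C (j ∸ k))) (pascal a k))) ⟩
      first + sumN j (λ k → ((a C k) + (a C suc k)) * (b C (j ∸ k)))
    ≡⟨ cong (λ s → first + s) (trans (sumN-cong j (λ k _ → *-distribʳ-+ (b C (j ∸ k)) (a C k) (a C suc k))) (sumN-+ j f g)) ⟩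
      first + (sumN j f + sumN j g)
    ≡⟨ solve 3 (λ x y z → x :+ (y :+ z) := y :+ (x :+ z)) refl first (sumN j f) (sumN j g) ⟩
      sumN j f + (first + sumN j g)
    ≡⟨ cong₂ _+_ (vandermonde a b j) (trans (sym (sumN-shift j (λ k → (a C k) * (b C (suc j ∸ k))))) (vandermonde a b (suc j))) ⟩
      (a + b) C j + (a + b) C suc j
    ≡⟨ sym (pascal (a + b) j) ⟩
      suc (a + b) C suc j
    ∎
    where
    first = 1 * (b C suc j)
    f = λ k → (a C k) * (b C (j ∸ k))
    g = λ k → (a C suc k) * (b C (j ∸ k))

  sum-CC : ∀ n j → sumN j (λ k → (n C k) * (j C k)) ≡ (j + n) C n
  sum-CC n j = begin
      sumN j (λ k → (n C k) * (j C k))           ≡⟨ sumN-cong j (λ k k≤j → cong ((n C k) *_) (nCk≡nC[n∸k] k≤j)) ⟩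
      sumN j (λ k → (n C k) * (j C (j ∸ k)))     ≡⟨ vandermonde n j j ⟩
      (n + j) C j                                ≡⟨ cong (_C j) (+-comm n j) ⟩
      (j + n) C j                                ≡⟨ C-sym j n ⟩
      (j + n) C n                                ∎

  sum-CsucC : ∀ n j → sumN j (λ k → (suc n C suc k) * (j C k)) ≡ (j + suc n) C n
  sum-CsucC n j = begin
      sumN j (λ k → (suc n C suc k) * (j C k))             ≡⟨ sumN-cong j (λ k k≤j → cong ((suc n C suc k) *_) (nCk≡nC[n∸k] k≤j)) ⟩
      sumN j (λ k → (suc n C suc k) * (j C (j ∸ k)))       ≡⟨ cong (_+ sumN j (λ k → (suc n C suc k) * (j C (j ∸ k)))) (sym vanishing-term) ⟩
      1 * (j C suc j) + sumN j (λ k → (suc n C suc k) * (j C (j ∸ k)))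
                                                           ≡⟨ sym (sumN-shift j (λ k → (suc n C k) * (j C (suc j ∸ k)))) ⟩
      sumN (suc j) (λ k → (suc n C k) * (j C (suc j ∸ k))) ≡⟨ vandermonde (suc n) j (suc j) ⟩
      (suc n + j) C suc j                                  ≡⟨ cong (λ z → suc z C suc j) (+-comm n j) ⟩
      (suc j + n) C suc j                                  ≡⟨ C-sym (suc j) n ⟩
      (suc j + n) C n                                      ≡⟨ cong (_C n) (sym (+-suc j n)) ⟩
      (j + suc n) C n                                      ∎
    where
    vanishing-term : 1 * (j C suc j) ≡ 0
    vanishing-term = trans (*-identityˡ _) (k>n⇒nCk≡0 {j} ≤-refl)

  Tsum : ℕ → (ℕ → ℕ) → ℕ → ℕ
  Tsum n g j = (n C j) * sumN j (λ k → g k * (j C k))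

  Rsum : ℕ → (ℕ → ℕ) → ℕ → ℕ
  Rsum n g m = sumN m (λ k → g k * (n C k) * ((n ∸ k ∸ 1) C (m ∸ k)))

  Rsum-zero : ∀ n g → Rsum n g 0 ≡ Tsum n g 0
  Rsum-zero n g = solve 1 (λ x → x :* con 1 :* con 1 := con 1 :* (x :* con 1)) refl (g 0)

  suc[n∸k∸1]≡n∸k : ∀ {n k} → k < n → suc (n ∸ k ∸ 1) ≡ n ∸ k
  suc[n∸k∸1]≡n∸k {suc n} {zero} _ = refl
  suc[n∸k∸1]≡n∸k {suc n} {suc k} (s≤s k<n) = suc[n∸k∸1]≡n∸k k<n

  -- The recurrence R_g(m+1) + R_g(m) = T_g(m+1) for m < n: merge the two sums
  -- with Pascal's rule, then use C(n,k) C(n-k,m+1-k) = C(n,m+1) C(m+1,k).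
  Rsum-step : ∀ n g m → suc m ≤ n → Rsum n g (suc m) + Rsum n g m ≡ Tsum n g (suc m)
  Rsum-step n g m m<n = begin
      (sumN m A + L) + sumN m B
    ≡⟨ solve 3 (λ a l b → (a :+ l) :+ b := (a :+ b) :+ l) refl (sumN m A) L (sumN m B) ⟩
      (sumN m A + sumN m B) + L
    ≡⟨ cong₂ _+_ (trans (sym (sumN-+ m A B)) (sumN-cong m pascal-step)) last-term ⟩
      sumN (suc m) D
    ≡⟨ sumN-cong (suc m) subset-step ⟩
      sumN (suc m) (λ k → (n C suc m) * (g k * (suc m C k)))
    ≡⟨ sumN-*ˡ (suc m) (n C suc m) _ ⟩
      Tsum n g (suc m)
    ∎
    where
    A = λ k → g k * (n C k) * ((n ∸ k ∸ 1) C (suc m ∸ k))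
    B = λ k → g k * (n C k) * ((n ∸ k ∸ 1) C (m ∸ k))
    D = λ k → g k * (n C k) * ((n ∸ k) C (suc m ∸ k))
    L = g (suc m) * (n C suc m) * ((n ∸ suc m ∸ 1) C (m ∸ m))

    pascal-step : ∀ k → k ≤ m → A k + B k ≡ D k
    pascal-step k k≤m = begin
        A k + B k
      ≡⟨ sym (*-distribˡ-+ (g k * (n C k)) _ _) ⟩
        g k * (n C k) * ((n ∸ k ∸ 1) C (suc m ∸ k) + (n ∸ k ∸ 1) C (m ∸ k))
      ≡⟨ cong (λ i → g k * (n C k) * ((n ∸ k ∸ 1) C i + (n ∸ k ∸ 1) C (m ∸ k))) (+-∸-assoc 1 k≤m) ⟩
        g k * (n C k) * ((n ∸ k ∸ 1) C suc (m ∸ k) + (n ∸ k ∸ 1) C (m ∸ k))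
      ≡⟨ cong (g k * (n C k) *_) (trans (+-comm ((n ∸ k ∸ 1) C suc (m ∸ k)) _) (sym (pascal (n ∸ k ∸ 1) (m ∸ k)))) ⟩
        g k * (n C k) * (suc (n ∸ k ∸ 1) C suc (m ∸ k))
      ≡⟨ cong₂ (λ u i → g k * (n C k) * (u C i)) (suc[n∸k∸1]≡n∸k (≤-trans (s≤s k≤m) m<n)) (sym (+-∸-assoc 1 k≤m)) ⟩
        D k
      ∎

    last-term : L ≡ D (suc m)
    last-term = trans (cong (λ i → g (suc m) * (n C suc m) * ((n ∸ suc m ∸ 1) C i)) (n∸n≡0 m))
                      (sym (cong (λ i → g (suc m) * (n C suc m) * ((n ∸ suc m) C i)) (n∸n≡0 m)))

    subset-step : ∀ k → k ≤ suc m → D k ≡ (n C suc m) * (g k * (suc m C k))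
    subset-step k k≤m+1 = begin
        g k * (n C k) * ((n ∸ k) C (suc m ∸ k))     ≡⟨ *-assoc (g k) (n C k) _ ⟩
        g k * ((n C k) * ((n ∸ k) C (suc m ∸ k)))   ≡⟨ cong (g k *_) (C-subset k≤m+1 m<n) ⟩
        g k * ((n C suc m) * (suc m C k))           ≡⟨ solve 3 (λ x y z → x :* (y :* z) := y :* (x :* z)) refl (g k) (n C suc m) (suc m C k) ⟩
        (n C suc m) * (g k * (suc m C k))           ∎

module RationalIdentities where

  open import Data.Nat using (zero; _!)
  open import Data.Nat.Combinatorics using (k>n⇒nCk≡0)
  import Data.Integer.Properties as ℤP
  open import Data.Rational using (_+_; _*_; -_; _/_; 1ℚ; toℚᵘ)
  open import Data.Rational.Unnormalised as ℚᵘ using (mkℚᵘ; *≡*)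
  import Data.Rational.Unnormalised.Properties as ℚᵘP
  open import Data.Sum using (inj₁; inj₂)
  open import Relation.Binary.PropositionalEquality
  import Data.Integer.Solver as ℤSolver
  import Data.Nat.Solver as ℕSolver
  open ≡-Reasoning
  open BinomialIdentities

  cast : ℕ → ℚ
  cast x = + x / 1

  cast-as-ℚᵘ : ∀ x → toℚᵘ (cast x) ℚᵘ.≃ mkℚᵘ (+ x) 0
  cast-as-ℚᵘ x = ℚP.toℚᵘ-fromℚᵘ (mkℚᵘ (+ x) 0)

  cast-+ : ∀ x y → cast (x ℕ.+ y) ≡ cast x + cast y
  cast-+ x y = ℚP.toℚᵘ-injective (ℚᵘP.≃-trans (cast-as-ℚᵘ (x ℕ.+ y)) (ℚᵘP.≃-trans in-ℚᵘ
      (ℚᵘP.≃-sym (ℚᵘP.≃-trans (ℚP.toℚᵘ-homo-+ (cast x) (cast y)) (ℚᵘP.+-cong (cast-as-ℚᵘ x) (cast-as-ℚᵘ y))))))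
    where
    open ℤSolver.+-*-Solver
    in-ℚᵘ : mkℚᵘ (+ (x ℕ.+ y)) 0 ℚᵘ.≃ (mkℚᵘ (+ x) 0 ℚᵘ.+ mkℚᵘ (+ y) 0)
    in-ℚᵘ = *≡* (trans (cong (ℤ._* ℤ.1ℤ) (ℤP.pos-+ x y))
      (solve 2 (λ a b → (a :+ b) :* con ℤ.1ℤ := (a :* con ℤ.1ℤ :+ b :* con ℤ.1ℤ) :* con ℤ.1ℤ) refl (+ x) (+ y)))

  cast-* : ∀ x y → cast (x ℕ.* y) ≡ cast x * cast y
  cast-* x y = ℚP.toℚᵘ-injective (ℚᵘP.≃-trans (cast-as-ℚᵘ (x ℕ.* y)) (ℚᵘP.≃-trans in-ℚᵘ
      (ℚᵘP.≃-sym (ℚᵘP.≃-trans (ℚP.toℚᵘ-homo-* (cast x) (cast y)) (ℚᵘP.*-cong (cast-as-ℚᵘ x) (cast-as-ℚᵘ y))))))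
    where
    in-ℚᵘ : mkℚᵘ (+ (x ℕ.* y)) 0 ℚᵘ.≃ (mkℚᵘ (+ x) 0 ℚᵘ.* mkℚᵘ (+ y) 0)
    in-ℚᵘ = *≡* (cong (ℤ._* ℤ.1ℤ) (ℤP.pos-* x y))

  exact-quotient : ∀ c d .{{_ : NonZero d}} → + (c ℕ.* d) / d ≡ cast c
  exact-quotient c (suc d) = ℚP.fromℚᵘ-cong {mkℚᵘ (+ (c ℕ.* suc d)) d} {mkℚᵘ (+ c) 0} (*≡* (trans (ℤP.*-identityʳ _) (ℤP.pos-* c (suc d))))

  1/n*n≡1 : ∀ n .{{_ : NonZero n}} → (ℤ.1ℤ / n) * cast n ≡ 1ℚ
  1/n*n≡1 (suc n) = ℚP.toℚᵘ-injective (ℚᵘP.≃-trans (ℚP.toℚᵘ-homo-* (ℤ.1ℤ / suc n) (cast (suc n)))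
      (ℚᵘP.≃-trans (ℚᵘP.*-cong (ℚP.toℚᵘ-fromℚᵘ (mkℚᵘ ℤ.1ℤ n)) (cast-as-ℚᵘ (suc n))) (*≡* unit-fraction)))
    where
    unit-fraction : (ℤ.1ℤ ℤ.* + suc n) ℤ.* ℤ.1ℤ ≡ ℤ.1ℤ ℤ.* + (suc n ℕ.* 1)
    unit-fraction = trans (ℤP.*-identityʳ _) (trans (ℤP.*-identityˡ _)
      (trans (cong +_ (sym (ℕP.*-identityʳ (suc n)))) (sym (ℤP.*-identityˡ _))))

  cross-multiply : ∀ M N A B .{{_ : NonZero M}} .{{_ : NonZero N}} → N ℕ.* A ≡ M ℕ.* B →
    (ℤ.1ℤ / M) * cast A ≡ (ℤ.1ℤ / N) * cast B
  cross-multiply M N A B NA≡MB = begin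
      1/M * cast A                                ≡⟨ sym (trans (cong (1/M * cast A *_) (1/n*n≡1 N)) (ℚP.*-identityʳ _)) ⟩
      1/M * cast A * (1/N * cast N)               ≡⟨ solve 4 (λ a b c d → a :* b :* (c :* d) := c :* a :* (d :* b)) refl 1/M (cast A) 1/N (cast N) ⟩
      1/N * 1/M * (cast N * cast A)               ≡⟨ cong (1/N * 1/M *_) (trans (sym (cast-* N A)) (trans (cong cast NA≡MB) (cast-* M B))) ⟩
      1/N * 1/M * (cast M * cast B)               ≡⟨ solve 4 (λ a b c d → c :* a :* (b :* d) := c :* d :* (a :* b)) refl 1/M (cast M) 1/N (cast B) ⟩
      1/N * cast B * (1/M * cast M)               ≡⟨ trans (cong (1/N * cast B *_) (1/n*n≡1 M)) (ℚP.*-identityʳ _) ⟩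
      1/N * cast B                                ∎
    where
    open ℚSolver.+-*-Solver
    1/M = ℤ.1ℤ / M
    1/N = ℤ.1ℤ / N

  +a-+b≡+[a∸b] : ∀ {a b} → b ≤ a → + a ℤ.- + b ≡ + (a ℕ.∸ b)
  +a-+b≡+[a∸b] {a} {b} b≤a = trans (ℤP.m-n≡m⊖n a b) (ℤP.⊖-≥ b≤a)

  fallingℤ-C : ∀ n k → fallingℤ (+ n) k ≡ + ((n C k) ℕ.* k !)
  fallingℤ-C n zero = refl
  fallingℤ-C n (suc k) with ℕP.≤-<-connex k n
  ... | inj₁ k≤n = begin
      fallingℤ (+ n) k ℤ.* (+ n ℤ.- + k)       ≡⟨ cong₂ ℤ._*_ (fallingℤ-C n k) (+a-+b≡+[a∸b] k≤n) ⟩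
      + ((n C k) ℕ.* k !) ℤ.* + (n ℕ.∸ k)       ≡⟨ sym (ℤP.pos-* ((n C k) ℕ.* k !) (n ℕ.∸ k)) ⟩
      + ((n C k) ℕ.* k ! ℕ.* (n ℕ.∸ k))         ≡⟨ cong +_ step ⟩
      + ((n C suc k) ℕ.* suc k !)               ∎
    where
    open ℕSolver.+-*-Solver
    step : (n C k) ℕ.* k ! ℕ.* (n ℕ.∸ k) ≡ (n C suc k) ℕ.* suc k !
    step = begin
      (n C k) ℕ.* k ! ℕ.* (n ℕ.∸ k)      ≡⟨ solve 3 (λ c f d → c :* f :* d := d :* c :* f) refl (n C k) (k !) (n ℕ.∸ k) ⟩
      (n ℕ.∸ k) ℕ.* (n C k) ℕ.* k !      ≡⟨ cong (ℕ._* k !) (sym (C-step n k)) ⟩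
      suc k ℕ.* (n C suc k) ℕ.* k !      ≡⟨ solve 3 (λ s c f → s :* c :* f := c :* (s :* f)) refl (suc k) (n C suc k) (k !) ⟩
      (n C suc k) ℕ.* suc k !            ∎
  ... | inj₂ n<k = begin
      fallingℤ (+ n) k ℤ.* (+ n ℤ.- + k)       ≡⟨ cong (ℤ._* (+ n ℤ.- + k)) (fallingℤ-C n k) ⟩
      + ((n C k) ℕ.* k !) ℤ.* (+ n ℤ.- + k)     ≡⟨ cong (λ c → + (c ℕ.* k !) ℤ.* (+ n ℤ.- + k)) (k>n⇒nCk≡0 n<k) ⟩
      + 0                                       ≡⟨ cong (λ c → + (c ℕ.* suc k !)) (sym (k>n⇒nCk≡0 (ℕP.m<n⇒m<1+n n<k))) ⟩
      + ((n C suc k) ℕ.* suc k !)               ∎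

  binom-C : ∀ a b → binom (+ a) (+ b) ≡ cast (a C b)
  binom-C a b = trans (cong (λ z → (z / b !) {{b ℕP.!≢0}}) (fallingℤ-C a b)) (exact-quotient (a C b) (b !) {{b ℕP.!≢0}})

  -- The coefficient C(n-k-1, m-k) of the corollary, for k ≤ m ≤ n; when
  -- k = n it is the coefficient C(-1,0) = 1 with negative top entry.
  binom-shifted-C : ∀ {n m k} → k ≤ m → m ≤ n →
    binom (+ n ℤ.- + k ℤ.- ℤ.1ℤ) (+ m ℤ.- + k) ≡ cast ((n ℕ.∸ k ℕ.∸ 1) C (m ℕ.∸ k))
  binom-shifted-C {n} {m} {k} k≤m m≤n with ℕP.m≤n⇒m<n∨m≡n (ℕP.≤-trans k≤m m≤n)
  ... | inj₁ k<n = begin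
      binom (+ n ℤ.- + k ℤ.- ℤ.1ℤ) (+ m ℤ.- + k)    ≡⟨ cong₂ binom (trans (cong (ℤ._- ℤ.1ℤ) (+a-+b≡+[a∸b] (ℕP.<⇒≤ k<n)))
                                                                              (+a-+b≡+[a∸b] (ℕP.m<n⇒0<n∸m k<n)))
                                                                       (+a-+b≡+[a∸b] k≤m) ⟩
      binom (+ (n ℕ.∸ k ℕ.∸ 1)) (+ (m ℕ.∸ k))       ≡⟨ binom-C (n ℕ.∸ k ℕ.∸ 1) (m ℕ.∸ k) ⟩
      cast ((n ℕ.∸ k ℕ.∸ 1) C (m ℕ.∸ k))            ∎
  ... | inj₂ refl with ℕP.≤-antisym k≤m m≤n
  ...   | refl rewrite +a-+b≡+[a∸b] (ℕP.≤-refl {k}) | ℕP.n∸n≡0 k = refl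

  sumTo-cong : ∀ m {f g : ℕ → ℚ} → (∀ k → k ≤ m → f k ≡ g k) → sumTo m f ≡ sumTo m g
  sumTo-cong zero f≡g = f≡g 0 z≤n
  sumTo-cong (suc m) f≡g = cong₂ _+_ (sumTo-cong m (λ k k≤m → f≡g k (ℕP.m≤n⇒m≤1+n k≤m))) (f≡g (suc m) ℕP.≤-refl)

  sumTo-cast : ∀ m (f : ℕ → ℕ) → sumTo m (λ k → cast (f k)) ≡ cast (sumN m f)
  sumTo-cast zero f = refl
  sumTo-cast (suc m) f = trans (cong (_+ cast (f (suc m))) (sumTo-cast m f)) (sym (cast-+ (sumN m f) (f (suc m))))

  sumTo-*ˡ : ∀ m x (f : ℕ → ℚ) → sumTo m (λ k → x * f k) ≡ x * sumTo m f
  sumTo-*ˡ zero x f = refl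
  sumTo-*ˡ (suc m) x f = trans (cong (_+ x * f (suc m)) (sumTo-*ˡ m x f)) (sym (ℚP.*-distribˡ-+ x (sumTo m f) (f (suc m))))

  sumTo-neg : ∀ m (f : ℕ → ℚ) → sumTo m (λ k → - f k) ≡ - sumTo m f
  sumTo-neg zero f = refl
  sumTo-neg (suc m) f = trans (cong (_+ - f (suc m)) (sumTo-neg m f)) (sym (ℚP.neg-distrib-+ (sumTo m f) (f (suc m))))

  signℚ-even : ∀ m → signℚ (m ℕ.+ m) ≡ 1ℚ
  signℚ-even zero = refl
  signℚ-even (suc m) rewrite ℕP.+-suc m m | signℚ-even m = refl

  alternating-inversion : ∀ N (t R : ℕ → ℚ) → R 0 ≡ t 0 → (∀ m → suc m ≤ N → R (suc m) + R m ≡ t (suc m)) →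
    ∀ m → m ≤ N → sumTo m (λ k → signℚ (m ℕ.+ k) * t k) ≡ R m
  alternating-inversion N t R R0 Rstep zero _ = trans (ℚP.*-identityˡ (t 0)) (sym R0)
  alternating-inversion N t R R0 Rstep (suc m) m<N = begin
      sumTo m (λ k → (- signℚ (m ℕ.+ k)) * t k) ℚ.+ signℚ (suc m ℕ.+ suc m) * t (suc m)
    ≡⟨ cong₂ _+_ previous (cong (_* t (suc m)) (signℚ-even (suc m))) ⟩
      - R m + 1ℚ * t (suc m)
    ≡⟨ cong (λ z → - R m + 1ℚ * z) (sym (Rstep m m<N)) ⟩
      - R m + 1ℚ * (R (suc m) + R m)
    ≡⟨ solve 2 (λ x y → :- y :+ con 1ℚ :* (x :+ y) := x) refl (R (suc m)) (R m) ⟩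
      R (suc m)
    ∎
    where
    open ℚSolver.+-*-Solver
    previous : sumTo m (λ k → (- signℚ (m ℕ.+ k)) * t k) ≡ - R m
    previous = begin
      sumTo m (λ k → (- signℚ (m ℕ.+ k)) * t k)   ≡⟨ sumTo-cong m (λ k _ → sym (ℚP.neg-distribˡ-* (signℚ (m ℕ.+ k)) (t k))) ⟩
      sumTo m (λ k → - (signℚ (m ℕ.+ k) * t k))   ≡⟨ sumTo-neg m _ ⟩
      - sumTo m (λ k → signℚ (m ℕ.+ k) * t k)     ≡⟨ cong -_ (alternating-inversion N t R R0 Rstep m (ℕP.<⇒≤ m<N)) ⟩
      - R m                                       ∎

  inversion-formula : ∀ n g m → m ≤ n →
    sumTo m (λ k → signℚ (m ℕ.+ k) * cast (Tsum n g k))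
      ≡ sumTo m (λ k → cast (g k ℕ.* (n C k) ℕ.* ((n ℕ.∸ k ℕ.∸ 1) C (m ℕ.∸ k))))
  inversion-formula n g m m≤n = trans
    (alternating-inversion n (λ k → cast (Tsum n g k)) (λ k → cast (Rsum n g k))
      (cong cast (Rsum-zero n g))
      (λ j j<n → trans (sym (cast-+ (Rsum n g (suc j)) (Rsum n g j))) (cong cast (Rsum-step n g j j<n)))
      m m≤n)
    (sym (sumTo-cast m _))

open BinomialIdentities
open RationalIdentities

-- First identity: the inversion formula for the weight g(k) = C(n,k), whose
-- binomial transform is C(n,k) C(k+n,n) by Vandermonde.
first-identity : (n n₁ : ℕ) → n₁ ℕ.≤ n →
  sumTo n₁ (λ k → signℚ (n₁ ℕ.+ k) ℚ.* (binom (+ n) (+ k) ℚ.* binom (+ (k ℕ.+ n)) (+ n)))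
    ≡ sumTo n₁ (λ k → (binom (+ n) (+ k) ℚ.* binom (+ n) (+ k)) ℚ.* binom (+ n ℤ.- + k ℤ.- ℤ.1ℤ) (+ n₁ ℤ.- + k))
first-identity n n₁ n₁≤n = begin
    sumTo n₁ (λ k → signℚ (n₁ ℕ.+ k) ℚ.* (binom (+ n) (+ k) ℚ.* binom (+ (k ℕ.+ n)) (+ n)))
  ≡⟨ sumTo-cong n₁ (λ k _ → cong (signℚ (n₁ ℕ.+ k) ℚ.*_) (transform k)) ⟩
    sumTo n₁ (λ k → signℚ (n₁ ℕ.+ k) ℚ.* cast (Tsum n (n C_) k))
  ≡⟨ inversion-formula n (n C_) n₁ n₁≤n ⟩
    sumTo n₁ (λ k → cast ((n C k) ℕ.* (n C k) ℕ.* ((n ℕ.∸ k ℕ.∸ 1) C (n₁ ℕ.∸ k))))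
  ≡⟨ sumTo-cong n₁ (λ k k≤n₁ → sym (summand k k≤n₁)) ⟩
    sumTo n₁ (λ k → (binom (+ n) (+ k) ℚ.* binom (+ n) (+ k)) ℚ.* binom (+ n ℤ.- + k ℤ.- ℤ.1ℤ) (+ n₁ ℤ.- + k))
  ∎
  where
  open ≡-Reasoning
  transform : ∀ k → binom (+ n) (+ k) ℚ.* binom (+ (k ℕ.+ n)) (+ n) ≡ cast (Tsum n (n C_) k)
  transform k = begin
    binom (+ n) (+ k) ℚ.* binom (+ (k ℕ.+ n)) (+ n)   ≡⟨ cong₂ ℚ._*_ (binom-C n k) (binom-C (k ℕ.+ n) n) ⟩
    cast (n C k) ℚ.* cast ((k ℕ.+ n) C n)             ≡⟨ sym (cast-* (n C k) _) ⟩
    cast ((n C k) ℕ.* ((k ℕ.+ n) C n))                ≡⟨ cong (λ s → cast ((n C k) ℕ.* s)) (sym (sum-CC n k)) ⟩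
    cast (Tsum n (n C_) k)                            ∎
  summand : ∀ k → k ≤ n₁ →
    (binom (+ n) (+ k) ℚ.* binom (+ n) (+ k)) ℚ.* binom (+ n ℤ.- + k ℤ.- ℤ.1ℤ) (+ n₁ ℤ.- + k)
      ≡ cast ((n C k) ℕ.* (n C k) ℕ.* ((n ℕ.∸ k ℕ.∸ 1) C (n₁ ℕ.∸ k)))
  summand k k≤n₁ = begin
    (binom (+ n) (+ k) ℚ.* binom (+ n) (+ k)) ℚ.* binom (+ n ℤ.- + k ℤ.- ℤ.1ℤ) (+ n₁ ℤ.- + k)
      ≡⟨ cong₂ ℚ._*_ (cong₂ ℚ._*_ (binom-C n k) (binom-C n k)) (binom-shifted-C k≤n₁ n₁≤n) ⟩
    cast (n C k) ℚ.* cast (n C k) ℚ.* cast ((n ℕ.∸ k ℕ.∸ 1) C (n₁ ℕ.∸ k))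
      ≡⟨ cong (ℚ._* cast ((n ℕ.∸ k ℕ.∸ 1) C (n₁ ℕ.∸ k))) (sym (cast-* (n C k) (n C k))) ⟩
    cast ((n C k) ℕ.* (n C k)) ℚ.* cast ((n ℕ.∸ k ℕ.∸ 1) C (n₁ ℕ.∸ k))
      ≡⟨ sym (cast-* ((n C k) ℕ.* (n C k)) _) ⟩
    cast ((n C k) ℕ.* (n C k) ℕ.* ((n ℕ.∸ k ℕ.∸ 1) C (n₁ ℕ.∸ k)))
      ∎

-- Second identity: the inversion formula for the weight g(k) = C(n,k+1), whose
-- binomial transform is C(n,k) C(k+n,n-1); absorption turns C(k+n,n-1)/n into
-- C(k+n+1,n)/(k+n+1).
second-identity : (n n₁ : ℕ) → n₁ ℕ.≤ n → {{_ : NonZero n}} →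
  sumTo n₁ (λ k → narayana n (+ (k ℕ.+ 1)) ℚ.* binom (+ n ℤ.- + k ℤ.- ℤ.1ℤ) (+ n₁ ℤ.- + k))
    ≡ sumTo n₁ (λ k → (signℚ (k ℕ.+ n₁) ℚ.* (ℤ.1ℤ ℚ./ suc (k ℕ.+ n))) ℚ.* (binom (+ n) (+ k) ℚ.* binom (+ (k ℕ.+ n ℕ.+ 1)) (+ n)))
second-identity n@(suc n′) n₁ n₁≤n = begin
    sumTo n₁ (λ k → narayana n (+ (k ℕ.+ 1)) ℚ.* binom (+ n ℤ.- + k ℤ.- ℤ.1ℤ) (+ n₁ ℤ.- + k))
  ≡⟨ sumTo-cong n₁ summand ⟩
    sumTo n₁ (λ k → 1/n ℚ.* cast (g k ℕ.* (n C k) ℕ.* ((n ℕ.∸ k ℕ.∸ 1) C (n₁ ℕ.∸ k))))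
  ≡⟨ sumTo-*ˡ n₁ 1/n _ ⟩
    1/n ℚ.* sumTo n₁ (λ k → cast (g k ℕ.* (n C k) ℕ.* ((n ℕ.∸ k ℕ.∸ 1) C (n₁ ℕ.∸ k))))
  ≡⟨ cong (1/n ℚ.*_) (sym (inversion-formula n g n₁ n₁≤n)) ⟩
    1/n ℚ.* sumTo n₁ (λ k → signℚ (n₁ ℕ.+ k) ℚ.* cast (Tsum n g k))
  ≡⟨ sym (sumTo-*ˡ n₁ 1/n _) ⟩
    sumTo n₁ (λ k → 1/n ℚ.* (signℚ (n₁ ℕ.+ k) ℚ.* cast (Tsum n g k)))
  ≡⟨ sumTo-cong n₁ (λ k _ → sym (transform k)) ⟩
    sumTo n₁ (λ k → (signℚ (k ℕ.+ n₁) ℚ.* (ℤ.1ℤ ℚ./ suc (k ℕ.+ n))) ℚ.* (binom (+ n) (+ k) ℚ.* binom (+ (k ℕ.+ n ℕ.+ 1)) (+ n)))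
  ∎
  where
  open ≡-Reasoning
  open ℚSolver.+-*-Solver
  1/n = ℤ.1ℤ ℚ./ n
  g : ℕ → ℕ
  g k = n C suc k

  summand : ∀ k → k ≤ n₁ →
    narayana n (+ (k ℕ.+ 1)) ℚ.* binom (+ n ℤ.- + k ℤ.- ℤ.1ℤ) (+ n₁ ℤ.- + k)
      ≡ 1/n ℚ.* cast (g k ℕ.* (n C k) ℕ.* ((n ℕ.∸ k ℕ.∸ 1) C (n₁ ℕ.∸ k)))
  summand k k≤n₁ = begin
      1/n ℚ.* (binom (+ n) (+ (k ℕ.+ 1)) ℚ.* binom (+ n) (+ (k ℕ.+ 1) ℤ.- ℤ.1ℤ)) ℚ.* binom (+ n ℤ.- + k ℤ.- ℤ.1ℤ) (+ n₁ ℤ.- + k)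
    ≡⟨ cong₂ (λ u v → 1/n ℚ.* u ℚ.* v) (cong₂ ℚ._*_ upper lower) (binom-shifted-C k≤n₁ n₁≤n) ⟩
      1/n ℚ.* (cast (g k) ℚ.* cast (n C k)) ℚ.* cast ((n ℕ.∸ k ℕ.∸ 1) C (n₁ ℕ.∸ k))
    ≡⟨ solve 4 (λ a b c d → a :* (b :* c) :* d := a :* (b :* c :* d)) refl 1/n (cast (g k)) (cast (n C k)) (cast ((n ℕ.∸ k ℕ.∸ 1) C (n₁ ℕ.∸ k))) ⟩
      1/n ℚ.* (cast (g k) ℚ.* cast (n C k) ℚ.* cast ((n ℕ.∸ k ℕ.∸ 1) C (n₁ ℕ.∸ k)))
    ≡⟨ cong (1/n ℚ.*_) (sym (trans (cast-* (g k ℕ.* (n C k)) _) (cong (ℚ._* cast ((n ℕ.∸ k ℕ.∸ 1) C (n₁ ℕ.∸ k))) (cast-* (g k) (n C k))))) ⟩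
      1/n ℚ.* cast (g k ℕ.* (n C k) ℕ.* ((n ℕ.∸ k ℕ.∸ 1) C (n₁ ℕ.∸ k)))
    ∎
    where
    k+1≡suc-k : + (k ℕ.+ 1) ≡ + suc k
    k+1≡suc-k = cong +_ (ℕP.+-comm k 1)
    upper : binom (+ n) (+ (k ℕ.+ 1)) ≡ cast (g k)
    upper = trans (cong (binom (+ n)) k+1≡suc-k) (binom-C n (suc k))
    lower : binom (+ n) (+ (k ℕ.+ 1) ℤ.- ℤ.1ℤ) ≡ cast (n C k)
    lower = trans (cong (binom (+ n)) (trans (cong (ℤ._- ℤ.1ℤ) k+1≡suc-k) (+a-+b≡+[a∸b] (s≤s z≤n)))) (binom-C n k)

  transform : ∀ k →
    (signℚ (k ℕ.+ n₁) ℚ.* (ℤ.1ℤ ℚ./ suc (k ℕ.+ n))) ℚ.* (binom (+ n) (+ k) ℚ.* binom (+ (k ℕ.+ n ℕ.+ 1)) (+ n))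
      ≡ 1/n ℚ.* (signℚ (n₁ ℕ.+ k) ℚ.* cast (Tsum n g k))
  transform k = begin
      (signℚ (k ℕ.+ n₁) ℚ.* 1/M) ℚ.* (binom (+ n) (+ k) ℚ.* binom (+ (k ℕ.+ n ℕ.+ 1)) (+ n))
    ≡⟨ cong₂ (λ u v → (u ℚ.* 1/M) ℚ.* v) (cong signℚ (ℕP.+-comm k n₁)) (cong₂ ℚ._*_ (binom-C n k) top) ⟩
      (σ ℚ.* 1/M) ℚ.* (cast (n C k) ℚ.* cast A)
    ≡⟨ solve 4 (λ a b c d → (a :* b) :* (c :* d) := a :* c :* (b :* d)) refl σ 1/M (cast (n C k)) (cast A) ⟩
      σ ℚ.* cast (n C k) ℚ.* (1/M ℚ.* cast A)
    ≡⟨ cong (σ ℚ.* cast (n C k) ℚ.*_) (cross-multiply (suc (k ℕ.+ n)) n A B (absorption n′≤k+n)) ⟩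
      σ ℚ.* cast (n C k) ℚ.* (1/n ℚ.* cast B)
    ≡⟨ solve 4 (λ a b c d → a :* c :* (b :* d) := b :* (a :* (c :* d))) refl σ 1/n (cast (n C k)) (cast B) ⟩
      1/n ℚ.* (σ ℚ.* (cast (n C k) ℚ.* cast B))
    ≡⟨ cong (λ z → 1/n ℚ.* (σ ℚ.* z)) (trans (sym (cast-* (n C k) B)) (cong (λ s → cast ((n C k) ℕ.* s)) (sym (sum-CsucC n′ k)))) ⟩
      1/n ℚ.* (σ ℚ.* cast (Tsum n g k))
    ∎
    where
    σ = signℚ (n₁ ℕ.+ k)
    1/M = ℤ.1ℤ ℚ./ suc (k ℕ.+ n)
    A = suc (k ℕ.+ n) C n
    B = (k ℕ.+ n) C n′
    n′≤k+n : n′ ≤ k ℕ.+ n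
    n′≤k+n = ℕP.≤-trans (ℕP.n≤1+n n′) (ℕP.m≤n+m n k)
    top : binom (+ (k ℕ.+ n ℕ.+ 1)) (+ n) ≡ cast A
    top = trans (cong (λ z → binom (+ z) (+ n)) (ℕP.+-comm (k ℕ.+ n) 1)) (binom-C (suc (k ℕ.+ n)) n)

corollary3p3 : (n n₁ : ℕ) → n₁ ℕ.≤ n →
    (sumTo n₁ (λ k → signℚ (n₁ ℕ.+ k) ℚ.* (binom (+ n) (+ k) ℚ.* binom (+ (k ℕ.+ n)) (+ n)))
      ≡ sumTo n₁ (λ k → (binom (+ n) (+ k) ℚ.* binom (+ n) (+ k)) ℚ.* binom (+ n ℤ.- + k ℤ.- ℤ.1ℤ) (+ n₁ ℤ.- + k)))
    × ({{_ : NonZero n}} →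
      sumTo n₁ (λ k → narayana n (+ (k ℕ.+ 1)) ℚ.* binom (+ n ℤ.- + k ℤ.- ℤ.1ℤ) (+ n₁ ℤ.- + k))
        ≡ sumTo n₁ (λ k → (signℚ (k ℕ.+ n₁) ℚ.* (ℤ.1ℤ ℚ./ suc (k ℕ.+ n))) ℚ.* (binom (+ n) (+ k) ℚ.* binom (+ (k ℕ.+ n ℕ.+ 1)) (+ n))))
corollary3p3 n n₁ n₁≤n = first-identity n n₁ n₁≤n , second-identity n n₁ n₁≤n
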